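{- For all integers $n$ and $k$ with $2\le k\le n-1$, $C_k(K_n)=n-k+2$, where $K_n$ is the complete graph on $n$ vertices.
   Context: All graphs are finite, simple and undirected. For an integer $k\ge 1$, a set $S\subseteq V(G)$ is a $k$-dominating set of $G$ if every vertex of $V(G)\setminus S$ has at least $k$ neighbours in $S$. Two sets $U_1,U_2\subseteq V(G)$ form a $k$-coalition if neither $U_1$ nor $U_2$ is a $k$-dominating set of $G$, but $U_1\cup U_2$ is. A $k$-coalition partition of $G$ is a partition $\Theta$ of $V(G)$ into nonempty sets such that every set of $\Theta$ either is a $k$-dominating set of $G$ with exactly $k$ elements, or forms a $k$-coalition with some other set of $\Theta$. The $k$-coalition number $C_k(G)$ is the maximum number of sets in a $k$-coalition partition of $G$. -}

module Defs where

open import Data.Nat using (ℕ; _≤_)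
open import Data.Bool using (Bool; true; false; not)
open import Data.Fin using (Fin; _≟_)
open import Data.Fin.Subset using (Subset; _∈_; _∉_; _∩_; _∪_; ∣_∣)
open import Data.Vec using (tabulate)
open import Data.Product using (Σ; ∃; _×_)
open import Data.Sum using (_⊎_)
open import Relation.Nullary using (¬_; does; yes; no)
open import Data.Empty using (⊥-elim)
open import Relation.Binary.PropositionalEquality using (_≡_; _≢_; refl) renaming (sym to ≡-sym)
open import Function.Definitions using (Surjective)

record Graph (n : ℕ) : Set where
  field
    adj   : Fin n → Fin n → Bool
    sym   : ∀ u v → adj u v ≡ adj v u
    irref : ∀ v → adj v v ≡ false
open Graph public

K : (n : ℕ) → Graph n
K n = record
  { adj   = λ u v → not (does (u ≟ v))
  ; sym   = symK
  ; irref = irrK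
  }
  where
  symK : ∀ (u v : Fin n) → not (does (u ≟ v)) ≡ not (does (v ≟ u))
  symK u v with u ≟ v | v ≟ u
  ... | yes _ | yes _ = refl
  ... | no _  | no _  = refl
  ... | yes p | no q  = ⊥-elim (q (≡-sym p))
  ... | no p  | yes q = ⊥-elim (p (≡-sym q))
  irrK : ∀ (v : Fin n) → not (does (v ≟ v)) ≡ false
  irrK v with v ≟ v
  ... | yes _ = refl
  ... | no ¬p = ⊥-elim (¬p refl)

module _ {n : ℕ} (G : Graph n) where

  N : Fin n → Subset n
  N v = tabulate (adj G v)

  IsKDominating : ℕ → Subset n → Set
  IsKDominating k S = ∀ v → v ∉ S → k ≤ ∣ N v ∩ S ∣

  IsKCoalition : ℕ → Subset n → Subset n → Set
  IsKCoalition k U₁ U₂ =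
    ¬ IsKDominating k U₁ × ¬ IsKDominating k U₂ × IsKDominating k (U₁ ∪ U₂)

  -- A partition of V(G) into m nonempty sets is encoded by a surjective
  -- class-assignment f : Fin n → Fin m; the i-th set is f⁻¹(i).
  Class : {m : ℕ} → (Fin n → Fin m) → Fin m → Subset n
  Class f i = tabulate (λ v → does (f v ≟ i))

  IsKCoalitionPartition : ℕ → (m : ℕ) → (Fin n → Fin m) → Set
  IsKCoalitionPartition k m f =
    Surjective _≡_ _≡_ f ×
    (∀ i → (IsKDominating k (Class f i) × ∣ Class f i ∣ ≡ k)
           ⊎ (Σ (Fin m) λ j → j ≢ i × IsKCoalition k (Class f i) (Class f j)))

  HasKCoalitionPartitionOfSize : ℕ → ℕ → Set
  HasKCoalitionPartitionOfSize k m = Σ (Fin n → Fin m) (IsKCoalitionPartition k m)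

  CoalitionNumberIs : ℕ → ℕ → Set
  CoalitionNumberIs k c =
    HasKCoalitionPartitionOfSize k c ×
    (∀ m → HasKCoalitionPartitionOfSize k m → m ≤ c)

-- Upper bound: in any graph with k ≤ n every k-dominating set has at least k
-- vertices (a vertex outside it already has k neighbours inside). So some class
-- of a k-coalition partition, together with a second class, covers at least k
-- vertices, and each of the other m − 2 classes covers at least one; hence
-- k + (m − 2) ≤ n. Lower bound: in K_n a set is k-dominating as soon as it has
-- k vertices, so one class of k − 1 vertices and n − k + 1 singletons form a
-- k-coalition partition, every singleton being a coalition partner of the big
-- class.
module Submission where

open import Defs hiding (sym)
open import Data.Nat using (ℕ; zero; suc; _≤_; _<_; _+_; _∸_; z≤n; s≤s)
open import Data.Nat.Properties
  using (≤-trans; ≤-reflexive; <⇒≤; <⇒≱; +-comm; +-assoc; +-suc; m≤m+n; m≤n+m;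
         +-mono-≤; +-monoʳ-≤; +-monoˡ-≤; m+n≤o⇒m≤o∸n; m+n∸m≡n; m≤n⇒∃[o]m+o≡n;
         +-0-commutativeMonoid; module ≤-Reasoning)
open import Data.Bool using (Bool; true; not)
open import Data.Fin using (Fin; zero; suc; _≟_; _↑ʳ_; punchIn)
open import Data.Fin.Properties using (punchInᵢ≢i)
open import Data.Fin.Subset using (Subset; _∈_; _∉_; _∩_; _∪_; _⊆_; ∣_∣; ⊥; ⊤; ∁; ⁅_⁆; inside; outside)
open import Data.Fin.Subset.Properties
  using (∣p∩q∣≤∣q∣; p⊆q⇒∣p∣≤∣q∣; x∈p∩q⁺; ∪-comm; ∪-identityˡ; ∣⊥∣≡0; ∣⊤∣≡n; ∣⁅x⁆∣≡1; x∈⁅y⁆⇒x≡y;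
         nonempty?; x∈∁p⇒x∉p; x∉∁p⇒x∈p)
open import Data.Vec using ([]; _∷_; tabulate; replicate)
open import Data.Vec.Properties using (lookup⇒[]=; lookup∘tabulate; tabulate∘lookup; tabulate-cong; lookup-replicate)
open import Data.Vec.Functional using (Vector; tail; removeAt)
open import Algebra.Properties.CommutativeMonoid.Sum +-0-commutativeMonoid
  using (sum; sum-syntax; sum-remove; sum-cong-≗; sum-replicate-zero)
open import Data.Product using (Σ; _,_)
open import Data.Sum using (inj₁; inj₂)
open import Data.Empty using (⊥-elim)
open import Function using (_∘_)
open import Function.Definitions using (Surjective)
open import Relation.Nullary using (¬_; does; yes; no)
open import Relation.Nullary.Decidable using (dec-true; dec-false)
open import Relation.Binary.PropositionalEquality
  using (_≡_; _≢_; refl; sym; trans; cong; cong₂; subst; module ≡-Reasoning)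

private
  variable
    n m : ℕ

∈-tabulate⁺ : {g : Fin n → Bool} {x : Fin n} → g x ≡ true → x ∈ tabulate g
∈-tabulate⁺ {g = g} {x} gx≡true = lookup⇒[]= x (tabulate g) (trans (lookup∘tabulate g x) gx≡true)

tabulate-outside≡⊥ : tabulate (λ (_ : Fin n) → outside) ≡ ⊥
tabulate-outside≡⊥ {n} =
  trans (tabulate-cong (λ i → sym (lookup-replicate i outside))) (tabulate∘lookup (replicate n outside))

tabulate-≟≡⁅⁆ : (j : Fin n) → tabulate (λ v → does (v ≟ j)) ≡ ⁅ j ⁆
tabulate-≟≡⁅⁆ zero    = cong (inside ∷_) tabulate-outside≡⊥
tabulate-≟≡⁅⁆ (suc j) = cong (outside ∷_) (tabulate-≟≡⁅⁆ j)

x∈p⇒0<∣p∣ : {x : Fin n} {p : Subset n} → x ∈ p → 0 < ∣ p ∣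
x∈p⇒0<∣p∣ {x = x} {p} x∈p = subst (_≤ ∣ p ∣) (∣⁅x⁆∣≡1 x) (p⊆q⇒∣p∣≤∣q∣ ⁅x⁆⊆p)
  where
  ⁅x⁆⊆p : ⁅ x ⁆ ⊆ p
  ⁅x⁆⊆p y∈⁅x⁆ = subst (_∈ p) (sym (x∈⁅y⁆⇒x≡y x y∈⁅x⁆)) x∈p

∣p∪q∣≤∣p∣+∣q∣ : (p q : Subset n) → ∣ p ∪ q ∣ ≤ ∣ p ∣ + ∣ q ∣
∣p∪q∣≤∣p∣+∣q∣ []            []            = z≤n
∣p∪q∣≤∣p∣+∣q∣ (outside ∷ p) (outside ∷ q) = ∣p∪q∣≤∣p∣+∣q∣ p q
∣p∪q∣≤∣p∣+∣q∣ (inside  ∷ p) (outside ∷ q) = s≤s (∣p∪q∣≤∣p∣+∣q∣ p q)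
∣p∪q∣≤∣p∣+∣q∣ (inside  ∷ p) (inside  ∷ q) =
  s≤s (≤-trans (∣p∪q∣≤∣p∣+∣q∣ p q) (≤-trans (m≤n+m _ 1) (≤-reflexive (sym (+-suc ∣ p ∣ ∣ q ∣)))))
∣p∪q∣≤∣p∣+∣q∣ (outside ∷ p) (inside  ∷ q) =
  ≤-trans (s≤s (∣p∪q∣≤∣p∣+∣q∣ p q)) (≤-reflexive (sym (+-suc ∣ p ∣ ∣ q ∣)))

∀≥1⇒n≤sum : (t : Vector ℕ n) → (∀ i → 1 ≤ t i) → n ≤ sum t
∀≥1⇒n≤sum {zero}  t t≥1 = z≤n
∀≥1⇒n≤sum {suc n} t t≥1 = +-mono-≤ (t≥1 zero) (∀≥1⇒n≤sum (tail t) (λ i → t≥1 (suc i)))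

head+lookup+n≤sum : ∀ {n} (t : Vector ℕ (suc (suc n))) → (∀ i → 1 ≤ t i) →
                    (j : Fin (suc n)) → t zero + t (suc j) + n ≤ sum t
head+lookup+n≤sum {n} t t≥1 j = begin
  t zero + t (suc j) + n                    ≡⟨ +-assoc (t zero) _ _ ⟩
  t zero + (t (suc j) + n)                  ≤⟨ +-monoʳ-≤ (t zero) (+-monoʳ-≤ (t (suc j)) rest≥n) ⟩
  t zero + (t (suc j) + sum (removeAt (tail t) j)) ≡⟨ cong (t zero +_) (sym (sum-remove (tail t))) ⟩
  sum t                                     ∎
  where
  open ≤-Reasoning
  rest≥n : n ≤ sum (removeAt (tail t) j)
  rest≥n = ∀≥1⇒n≤sum (removeAt (tail t) j) (λ i → t≥1 (suc (punchIn j i)))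

sum-suc-at : (t u : Vector ℕ m) (x : Fin m) → t x ≡ suc (u x) → (∀ i → i ≢ x → t i ≡ u i) →
             sum t ≡ suc (sum u)
sum-suc-at {suc m} t u x tx≡1+ux t≗u = begin
  sum t                         ≡⟨ sum-remove t ⟩
  t x + sum (removeAt t x)      ≡⟨ cong₂ _+_ tx≡1+ux (sum-cong-≗ (λ i → t≗u _ (punchInᵢ≢i x i))) ⟩
  suc (u x + sum (removeAt u x)) ≡⟨ cong suc (sym (sum-remove u)) ⟩
  suc (sum u)                   ∎
  where open ≡-Reasoning

-- Stated for the bare vectors because Class G f i unfolds to them whatever G is.
∑∣preimage∣≡n : (f : Fin n → Fin m) → ∑[ i < m ] ∣ tabulate (λ v → does (f v ≟ i)) ∣ ≡ n
∑∣preimage∣≡n {zero}  {m} f = sum-replicate-zero m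
∑∣preimage∣≡n {suc n} {m} f = trans (sum-suc-at _ _ (f zero) fresh rest) (cong suc (∑∣preimage∣≡n (f ∘ suc)))
  where
  preimage′ : Fin m → Subset n
  preimage′ i = tabulate (λ v → does (f (suc v) ≟ i))
  fresh : ∣ does (f zero ≟ f zero) ∷ preimage′ (f zero) ∣ ≡ suc ∣ preimage′ (f zero) ∣
  fresh = cong (λ b → ∣ b ∷ preimage′ (f zero) ∣) (dec-true (f zero ≟ f zero) refl)
  rest : ∀ i → i ≢ f zero → ∣ does (f zero ≟ i) ∷ preimage′ i ∣ ≡ ∣ preimage′ i ∣
  rest i i≢f0 = cong (λ b → ∣ b ∷ preimage′ i ∣) (dec-false (f zero ≟ i) (λ e → i≢f0 (sym e)))

module _ {n : ℕ} (G : Graph n) {k : ℕ} where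

  dominating⇒k≤∣S∣ : {S : Subset n} → k ≤ n → IsKDominating G k S → k ≤ ∣ S ∣
  dominating⇒k≤∣S∣ {S} k≤n S-dom with nonempty? (∁ S)
  ... | yes (v , v∈∁S) = ≤-trans (S-dom v (x∈∁p⇒x∉p v∈∁S)) (∣p∩q∣≤∣q∣ (N G v) S)
  ... | no  ∁S-empty   = ≤-trans k≤n (subst (_≤ ∣ S ∣) (∣⊤∣≡n n) (p⊆q⇒∣p∣≤∣q∣ ⊤⊆S))
    where
    ⊤⊆S : ⊤ ⊆ S
    ⊤⊆S {v} _ = x∉∁p⇒x∈p (λ v∈∁S → ∁S-empty (v , v∈∁S))

  IsKCoalition-sym : {U₁ U₂ : Subset n} → IsKCoalition G k U₁ U₂ → IsKCoalition G k U₂ U₁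
  IsKCoalition-sym {U₁} {U₂} (¬dom₁ , ¬dom₂ , dom) = ¬dom₂ , ¬dom₁ , subst (IsKDominating G k) (∪-comm U₁ U₂) dom

  class-nonempty : {m : ℕ} {f : Fin n → Fin m} → Surjective _≡_ _≡_ f → ∀ i → 0 < ∣ Class G f i ∣
  class-nonempty {f = f} surj i with surj i
  ... | x , fx≡i = x∈p⇒0<∣p∣ {p = Class G f i} (∈-tabulate⁺ (dec-true (f x ≟ i) (fx≡i refl)))

  coalitionPartition-size≤ : {m : ℕ} → k ≤ n → HasKCoalitionPartitionOfSize G k m → m ≤ n ∸ k + 2
  coalitionPartition-size≤ {zero}        _   _                  = z≤n
  coalitionPartition-size≤ {suc zero}    _   _                  = ≤-trans (s≤s z≤n) (m≤n+m 2 (n ∸ k))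
  coalitionPartition-size≤ {suc (suc m)} k≤n (f , surj , coal) =
    ≤-trans (≤-reflexive (+-comm 2 m)) (+-monoˡ-≤ 2 (m+n≤o⇒m≤o∸n m (subst (_≤ n) (+-comm k m) k+m≤n)))
    where
    c : Vector ℕ (suc (suc m))
    c i = ∣ Class G f i ∣
    partner : Σ (Fin (suc m)) λ j → k ≤ c zero + c (suc j)
    partner with coal zero
    ... | inj₁ (_ , ∣C₀∣≡k)          = zero , ≤-trans (≤-reflexive (sym ∣C₀∣≡k)) (m≤m+n _ _)
    ... | inj₂ (zero , 0≢0 , _)       = ⊥-elim (0≢0 refl)
    ... | inj₂ (suc j , _ , _ , _ , dom) =
      j , ≤-trans (dominating⇒k≤∣S∣ k≤n dom) (∣p∪q∣≤∣p∣+∣q∣ (Class G f zero) (Class G f (suc j)))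
    k+m≤n : k + m ≤ n
    k+m≤n with j , k≤c₀+cⱼ ← partner = begin
      k + m                  ≤⟨ +-monoˡ-≤ m k≤c₀+cⱼ ⟩
      c zero + c (suc j) + m ≤⟨ head+lookup+n≤sum c (class-nonempty surj) j ⟩
      sum c                  ≡⟨ ∑∣preimage∣≡n f ⟩
      n                      ∎
      where open ≤-Reasoning

S⊆N-K∩S : {S : Subset n} {v : Fin n} → v ∉ S → S ⊆ N (K n) v ∩ S
S⊆N-K∩S {S = S} {v} v∉S {u} u∈S = x∈p∩q⁺ (∈-tabulate⁺ (cong not (dec-false (v ≟ u) v≢u)) , u∈S)
  where
  v≢u : v ≢ u
  v≢u v≡u = v∉S (subst (_∈ S) (sym v≡u) u∈S)

K-dominating : {k : ℕ} {S : Subset n} → k ≤ ∣ S ∣ → IsKDominating (K n) k S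
K-dominating k≤∣S∣ v v∉S = ≤-trans k≤∣S∣ (p⊆q⇒∣p∣≤∣q∣ (S⊆N-K∩S v∉S))

lumpFirst : ∀ a {b} → Fin (a + b) → Fin (suc b)
lumpFirst zero    v       = suc v
lumpFirst (suc a) zero    = zero
lumpFirst (suc a) (suc v) = lumpFirst a v

lumpFirst-↑ʳ : ∀ a {b} (j : Fin b) → lumpFirst a (a ↑ʳ j) ≡ suc j
lumpFirst-↑ʳ zero    j = refl
lumpFirst-↑ʳ (suc a) j = lumpFirst-↑ʳ a j

∣lump∣≡a : ∀ a {b} → ∣ Class (K (a + b)) (lumpFirst a) zero ∣ ≡ a
∣lump∣≡a zero {b} = trans (cong ∣_∣ (tabulate-outside≡⊥ {b})) (∣⊥∣≡0 b)
∣lump∣≡a (suc a)  = cong suc (∣lump∣≡a a)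

∣single∣≡1 : ∀ a {b} (j : Fin b) → ∣ Class (K (a + b)) (lumpFirst a) (suc j) ∣ ≡ 1
∣single∣≡1 zero    j = trans (cong ∣_∣ (tabulate-≟≡⁅⁆ j)) (∣⁅x⁆∣≡1 j)
∣single∣≡1 (suc a) j = ∣single∣≡1 a j

∣lump∪single∣≡1+a : ∀ a {b} (j : Fin b) →
  ∣ Class (K (a + b)) (lumpFirst a) zero ∪ Class (K (a + b)) (lumpFirst a) (suc j) ∣ ≡ suc a
∣lump∪single∣≡1+a zero {b} j = begin
  ∣ Class (K b) (lumpFirst zero) zero ∪ Class (K b) (lumpFirst zero) (suc j) ∣
    ≡⟨ cong ∣_∣ (cong₂ _∪_ (tabulate-outside≡⊥ {b}) (tabulate-≟≡⁅⁆ j)) ⟩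
  ∣ ⊥ ∪ ⁅ j ⁆ ∣ ≡⟨ cong ∣_∣ (∪-identityˡ ⁅ j ⁆) ⟩
  ∣ ⁅ j ⁆ ∣    ≡⟨ ∣⁅x⁆∣≡1 j ⟩
  1            ∎
  where open ≡-Reasoning
∣lump∪single∣≡1+a (suc a) j = cong suc (∣lump∪single∣≡1+a a j)

module _ (d o : ℕ) where

  private
    k : ℕ
    k = suc (suc d)
    Kₙ : Graph (suc d + suc o)
    Kₙ = K (suc d + suc o)

  k≤n : k ≤ suc d + suc o
  k≤n = s≤s (≤-trans (s≤s (m≤m+n d o)) (≤-reflexive (sym (+-suc d o))))

  small⇒¬dominating : {S : Subset (suc d + suc o)} → ∣ S ∣ < k → ¬ IsKDominating Kₙ k S
  small⇒¬dominating ∣S∣<k S-dom = <⇒≱ ∣S∣<k (dominating⇒k≤∣S∣ Kₙ k≤n S-dom)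

  lump-single-coalition : (j : Fin (suc o)) →
    IsKCoalition Kₙ k (Class Kₙ (lumpFirst (suc d)) zero) (Class Kₙ (lumpFirst (suc d)) (suc j))
  lump-single-coalition j =
      small⇒¬dominating (≤-reflexive (cong suc (∣lump∣≡a (suc d))))
    , small⇒¬dominating (≤-trans (≤-reflexive (cong suc (∣single∣≡1 (suc d) j))) (s≤s (s≤s z≤n)))
    , K-dominating (≤-reflexive (sym (∣lump∪single∣≡1+a (suc d) j)))

  lumpFirst-partition : IsKCoalitionPartition Kₙ k (suc (suc o)) (lumpFirst (suc d))
  lumpFirst-partition = surj , λ
    { zero    → inj₂ (suc zero , (λ ()) , lump-single-coalition zero)
    ; (suc j) → inj₂ (zero , (λ ()) , IsKCoalition-sym Kₙ (lump-single-coalition j))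
    }
    where
    surj : Surjective _≡_ _≡_ (lumpFirst (suc d))
    surj zero    = zero , λ { refl → refl }
    surj (suc j) = suc d ↑ʳ j , λ { refl → lumpFirst-↑ʳ (suc d) j }

K-coalitionPartition : {n k : ℕ} → 2 ≤ k → k ≤ n → HasKCoalitionPartitionOfSize (K n) k (n ∸ k + 2)
K-coalitionPartition {k = suc (suc d)} (s≤s (s≤s z≤n)) k≤n
  with o , refl ← m≤n⇒∃[o]m+o≡n k≤n
  rewrite m+n∸m≡n (suc (suc d)) o | +-comm o 2 =
    subst (λ n → HasKCoalitionPartitionOfSize (K n) (suc (suc d)) (suc (suc o)))
          (+-suc (suc d) o) (lumpFirst (suc d) , lumpFirst-partition d o)

theorem5 : (n k : ℕ) → 2 ≤ k → k < n →
    CoalitionNumberIs (K n) k (n ∸ k + 2)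
theorem5 n k 2≤k k<n =
  K-coalitionPartition 2≤k (<⇒≤ k<n) , λ m → coalitionPartition-size≤ (K n) (<⇒≤ k<n)
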